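{- Let $G$ be a finite graph without loops and $k\ge 1$ an integer. Then $\mathrm{B}(\Omega'_{2k+1}(G))$ $\mathbb{Z}_2$-collapses to its subcomplex induced by the vertex set $\mathrm{im}\,\phi\times\{\circ,\bullet\}$ (this subcomplex is isomorphic to $\mathrm{B}(\Omega_{2k-1}(G))$).
   Context: Graphs are finite with symmetric adjacency. For $A,B\subseteq V(G)$, $A\bowtie B$ means every vertex of $A$ is adjacent to every vertex of $B$; $\mathrm{CN}(A)=\bigcap_{v\in A}N(v)$ ($\mathrm{CN}(\emptyset)=V(G)$). For $k=2\ell+1$, $\Omega_k(G)$ has vertices the tuples $\mathbf{A}=(A_0,\dots,A_\ell)$ of subsets of $V(G)$ with $|A_0|=1$ and $A_{i-1}\bowtie A_i$; $\mathbf{A},\mathbf{B}$ are adjacent iff $A_{i-1}\subseteq B_i$, $B_{i-1}\subseteq A_i$ ($i=1,\dots,\ell$) and $A_\ell\bowtie B_\ell$. For a vertex $\mathbf{A}=(A_0,\dots,A_k)$ of $\Omega_{2k+1}(G)$ set $\phi(\mathbf{A})=(A_0,\dots,A_{k-1},\mathrm{CN}(A_{k-1}))$, again a vertex of $\Omega_{2k+1}(G)$. The graph $\Omega'_{2k+1}(G)$ is obtained from $\Omega_{2k+1}(G)$ by adding, for every edge $\{\mathbf{A},\mathbf{B}\}$ of $\Omega_{2k+1}(G)$, the edges $\{\mathbf{A},\phi(\mathbf{B})\}$, $\{\phi(\mathbf{A}),\mathbf{B}\}$, $\{\phi(\mathbf{A}),\phi(\mathbf{B})\}$. Box complex: after deleting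 isolated vertices of a graph $H$, $\mathrm{B}(H)$ is the simplicial complex on $V(H)\times\{\circ,\bullet\}$ whose simplices are the nonempty $\sigma$ with $\sigma^\circ\bowtie\sigma^\bullet$ and $\mathrm{CN}(\sigma^\circ),\mathrm{CN}(\sigma^\bullet)\ne\emptyset$ (where $\sigma^\circ=\{v:v^\circ\in\sigma\}$, $\sigma^\bullet=\{v:v^\bullet\in\sigma\}$), with involution $v^\circ\leftrightarrow v^\bullet$. The subcomplex induced by a vertex set $W$ consists of the simplices contained in $W$. Collapses: if $\tau$ is a simplex of a complex $K$ contained in exactly one other simplex $\sigma\ne\tau$, removing $\tau,\sigma$ is an elementary collapse. For a complex with a free simplicial involution, a $\mathbb{Z}_2$-elementary collapse removes $\tau,\sigma$ together with their images $-\tau,-\sigma$ (all four removals being valid). $K$ $\mathbb{Z}_2$-collapses to $K'$ if $K'$ is obtained from $K$ by a sequence of $\mathbb{Z}_2$-elementary collapses. -}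

module Defs where

open import Data.Nat using (ℕ; zero; suc)
open import Data.Fin using (Fin; zero; suc; inject₁; fromℕ)
open import Data.Fin.Subset using (Subset; _∈_; ∣_∣; _⊆_)
open import Data.Bool using (Bool; true; false; _∧_; _∨_; not)
open import Data.Vec using (Vec; []; _∷_; lookup; tabulate; head)
open import Data.Product using (Σ; _×_; _,_)
open import Data.Sum using (_⊎_)
open import Relation.Binary.PropositionalEquality using (_≡_)
open import Relation.Nullary using (¬_)
open import Level using (0ℓ) renaming (suc to lsuc)

-- Generic: finite simplicial complexes, represented by predicates on
-- simplices; a simplex is a (finite, since V will be finite) vertex set
-- given by its characteristic function V → Bool. Simplices are compared
-- up to extensional equality _≐_.

Simplex : Set → Set
Simplex V = V → Bool

_∈ₛ_ : {V : Set} → V → Simplex V → Set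
v ∈ₛ s = s v ≡ true

_⊆ₛ_ : {V : Set} → Simplex V → Simplex V → Set
s ⊆ₛ t = ∀ v → v ∈ₛ s → v ∈ₛ t

_≐_ : {V : Set} → Simplex V → Simplex V → Set
s ≐ t = (s ⊆ₛ t) × (t ⊆ₛ s)

Complex : Set → Set₁
Complex V = Simplex V → Set

Remove : {V : Set} → Complex V → Simplex V → Simplex V → Complex V
Remove K τ σ ρ = K ρ × ¬ (ρ ≐ τ) × ¬ (ρ ≐ σ)

FreePair : {V : Set} → Complex V → Simplex V → Simplex V → Set
FreePair K τ σ =
  K τ × K σ × (τ ⊆ₛ σ) × ¬ (σ ≐ τ) ×
  (∀ ρ → K ρ → τ ⊆ₛ ρ → (ρ ≐ τ) ⊎ (ρ ≐ σ))

_·_ : {V : Set} → (V → V) → Simplex V → Simplex V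
(ν · s) v = s (ν v)

data Z₂Collapses {V : Set} (ν : V → V) : Complex V → Complex V → Set₁ where
  done : {K K' : Complex V} →
         (∀ ρ → (K ρ → K' ρ) × (K' ρ → K ρ)) → Z₂Collapses ν K K'
  step : {K K' : Complex V} (τ σ : Simplex V) →
         FreePair K τ σ →
         FreePair (Remove K τ σ) (ν · τ) (ν · σ) →
         Z₂Collapses ν (Remove (Remove K τ σ) (ν · τ) (ν · σ)) K' →
         Z₂Collapses ν K K'

Induced : {V : Set} → Complex V → (V → Set) → Complex V
Induced K W σ = K σ × (∀ v → v ∈ₛ σ → W v)

-- Box complex of a graph H given by an adjacency relation on a type U.
-- Isolated vertices never occur in simplices.

data Pole : Set where
  ○ ● : Pole

flip : Pole → Pole
flip ○ = ●
flip ● = ○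

swap : {U : Set} → U × Pole → U × Pole
swap (u , p) = u , flip p

Box : {U : Set} → (U → U → Set) → Complex (U × Pole)
Box {U} Adj σ =
  Σ (U × Pole) (λ x → x ∈ₛ σ) ×
  (∀ a b → (a , ○) ∈ₛ σ → (b , ●) ∈ₛ σ → Adj a b) ×
  Σ U (λ c → ∀ a → (a , ○) ∈ₛ σ → Adj a c) ×
  Σ U (λ c → ∀ a → (a , ●) ∈ₛ σ → Adj a c)

module _ {n : ℕ} (E : Fin n → Fin n → Bool) where

  allFin : {m : ℕ} → (Fin m → Bool) → Bool
  allFin {zero} f = true
  allFin {suc m} f = f zero ∧ allFin (λ i → f (suc i))

  -- common neighbourhood CN(A) (CN(∅) = V(G))
  CN : Subset n → Subset n
  CN A = tabulate (λ v → allFin (λ u → not (lookup A u) ∨ E u v))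

  _⋈_ : Subset n → Subset n → Set
  A ⋈ B = ∀ u v → u ∈ A → v ∈ B → E u v ≡ true

  -- Tuples (A₀,…,A_ℓ) are vectors of length suc ℓ.
  -- Vertices of Ω_{2ℓ+1}(G):
  IsΩVertex : {ℓ : ℕ} → Vec (Subset n) (suc ℓ) → Set
  IsΩVertex {ℓ} A =
    (∣ head A ∣ ≡ 1) ×
    (∀ (i : Fin ℓ) → lookup A (inject₁ i) ⋈ lookup A (suc i))

  ΩAdj : {ℓ : ℕ} → Vec (Subset n) (suc ℓ) → Vec (Subset n) (suc ℓ) → Set
  ΩAdj {ℓ} A B =
    IsΩVertex A × IsΩVertex B ×
    (∀ (i : Fin ℓ) → lookup A (inject₁ i) ⊆ lookup B (suc i)) ×
    (∀ (i : Fin ℓ) → lookup B (inject₁ i) ⊆ lookup A (suc i)) ×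
    (lookup A (fromℕ ℓ) ⋈ lookup B (fromℕ ℓ))

  -- φ(A₀,…,A_k) = (A₀,…,A_{k-1}, CN(A_{k-1}))   (k ≥ 1)
  φ : {m : ℕ} → Vec (Subset n) (suc (suc m)) → Vec (Subset n) (suc (suc m))
  φ {zero} (a ∷ b ∷ []) = a ∷ CN a ∷ []
  φ {suc m} (a ∷ rest) = a ∷ φ rest

  -- Adjacency in Ω'_{2k+1}(G), k = suc m
  Ω'Adj : {m : ℕ} → Vec (Subset n) (suc (suc m)) → Vec (Subset n) (suc (suc m)) → Set
  Ω'Adj X Y = Σ _ λ A → Σ _ λ B → ΩAdj A B ×
    ((X ≡ A) ⊎ (X ≡ φ A)) × ((Y ≡ B) ⊎ (Y ≡ φ B))

  ImφPoles : {m : ℕ} → Vec (Subset n) (suc (suc m)) × Pole → Set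
  ImφPoles (X , _) = Σ _ λ A → IsΩVertex A × (X ≡ φ A)

-- Fix a vertex X of Ω_{2k+1}(G) outside im φ and put a = X°, b = φ(X)°.  In Ω′ the vertex
-- φ(X) is adjacent to every neighbour of X, so adding b to a simplex containing a gives a
-- simplex, and so does removing it; and X has no loop (a loop A ~ A in Ω would force
-- A₀ ⊆ A₁ and A₀ ⋈ A₁, a loop in G), so no simplex contains both a and its antipode X•.
-- Hence τ ↦ τ ∪ {b} (a ∈ τ ∌ b) pairs off the simplices containing a, disjointly from the
-- antipodal pairs.  Removing the pairs together with their antipodes from the largest τ
-- downwards, each τ is a free face of τ ∪ {b} when its turn comes, so the stars of X° and X•
-- are Z₂-collapsed away.  Doing this for every such X leaves exactly the simplices on
-- im φ × {○,●}: a vertex of a simplex has an Ω′-neighbour, so it is a vertex of Ω or in im φ.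

module Submission where

open import Defs
open import Data.Nat using (ℕ; suc)
open import Data.Fin using (Fin; zero)
open import Data.Bool using (Bool; true; false)
open import Relation.Binary.PropositionalEquality
  using (_≡_; _≢_; _≗_; refl; sym; trans; cong; subst)
open import Level using (0ℓ)
open import Function using (_∘_; id; const)
open import Data.Empty using (⊥; ⊥-elim)
open import Data.Product using (Σ; ∃; _×_; _,_; proj₁; proj₂)
open import Data.Sum using (_⊎_; inj₁; inj₂; [_,_]; [_,_]′)
import Data.Sum as Sum
open import Data.List using (List; []; _∷_; cartesianProduct; cartesianProductWith; filter)
open import Data.List.Membership.Propositional using (_∈_; _∉_; lose)
open import Data.List.Membership.Propositional.Properties
  using (∈-cartesianProduct⁺; ∈-cartesianProductWith⁺; ∈-filter⁺; ∈-filter⁻)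
open import Data.List.Relation.Unary.Any using (here; there; any?; satisfied)
open import Data.List.Relation.Unary.All using (All; []; _∷_)
import Data.List.Relation.Unary.All as All
open import Data.List.Relation.Unary.All.Properties using (all-filter)
open import Data.Vec using (Vec; []; _∷_; head)
import Data.Vec.Properties as Vec
import Data.Product.Properties as Product
import Data.Nat.Properties as ℕ
open import Data.Fin.Properties using (all?)
open import Data.Fin.Subset using (Subset; ∣_∣; Nonempty)
open import Data.Fin.Subset.Properties using (nonempty?; Empty-unique; ∣⊥∣≡0; _⊆?_)
  renaming (_∈?_ to _∈ˢ?_)
open import Data.Bool.Properties using () renaming (_≟_ to _≟ᴮ_)
open import Relation.Nullary using (¬_; Dec; yes; no; ¬?; contradiction)
open import Relation.Nullary.Decidable
  using (_×-dec_; _→-dec_; _⊎-dec_; decidable-stable; map′)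
open import Relation.Unary using (Pred; Decidable; _∪_; ∅; _⊆_)
open import Relation.Unary.Properties using (_∪?_; ∅?)
open import Relation.Binary.Definitions using (DecidableEquality; _Respects_)

private
  variable
    A B V : Set
    s t u : Simplex V
    K L M : Complex V
    ρ τ : Simplex V

record Enumeration (A : Set) : Set where
  field
    elements : List A
    complete : ∀ x → x ∈ elements

open Enumeration

Bool-enum : Enumeration Bool
Bool-enum = record
  { elements = true ∷ false ∷ []
  ; complete = λ { true → here refl ; false → there (here refl) } }

Pole-enum : Enumeration Pole
Pole-enum = record
  { elements = ○ ∷ ● ∷ []
  ; complete = λ { ○ → here refl ; ● → there (here refl) } }

×-enum : Enumeration A → Enumeration B → Enumeration (A × B)
×-enum eA eB = record
  { elements = cartesianProduct (elements eA) (elements eB)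
  ; complete = λ (x , y) → ∈-cartesianProduct⁺ (complete eA x) (complete eB y) }

Vec-enum : Enumeration A → ∀ k → Enumeration (Vec A k)
Vec-enum e 0 = record { elements = [] ∷ [] ; complete = λ { [] → here refl } }
Vec-enum e (suc k) = record
  { elements = cartesianProductWith _∷_ (elements e) (elements (Vec-enum e k))
  ; complete = λ { (x ∷ xs) →
      ∈-cartesianProductWith⁺ _∷_ (complete e x) (complete (Vec-enum e k) xs) } }

∃? : {P : Pred A 0ℓ} → Enumeration A → Decidable P → Dec (∃ P)
∃? e P? = map′ satisfied (λ (x , p) → lose (complete e x) p) (any? P? (elements e))

∀? : {P : Pred A 0ℓ} → Enumeration A → Decidable P → Dec (∀ x → P x)
∀? e P? = map′ (λ ¬∃ x → decidable-stable (P? x) (λ ¬p → ¬∃ (x , ¬p)))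
               (λ ∀P (x , ¬p) → ¬p (∀P x))
               (¬? (∃? e (¬? ∘ P?)))

≐-refl : s ≐ s
≐-refl = (λ _ → id) , (λ _ → id)

≐-sym : s ≐ t → t ≐ s
≐-sym (s⊆t , t⊆s) = t⊆s , s⊆t

≐-trans : s ≐ t → t ≐ u → s ≐ u
≐-trans (s⊆t , t⊆s) (t⊆u , u⊆t) = (λ v → t⊆u v ∘ s⊆t v) , (λ v → t⊆s v ∘ u⊆t v)

≗⇒≐ : s ≗ t → s ≐ t
≗⇒≐ s≗t = (λ v → trans (sym (s≗t v))) , (λ v → trans (s≗t v))

≐⇒≗ : s ≐ t → s ≗ t
≐⇒≗ {s = s} {t = t} (s⊆t , t⊆s) v with s v in sv | t v in tv
... | true  | true  = refl
... | false | false = refl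
... | true  | false = contradiction (trans (sym (s⊆t v sv)) tv) λ ()
... | false | true  = contradiction (trans (sym (t⊆s v tv)) sv) λ ()

infix 4 _≅_
_≅_ : Complex V → Complex V → Set
K ≅ L = ∀ ρ → (K ρ → L ρ) × (L ρ → K ρ)

≅-sym : K ≅ L → L ≅ K
≅-sym K≅L ρ = proj₂ (K≅L ρ) , proj₁ (K≅L ρ)

≅-trans : K ≅ L → L ≅ M → K ≅ M
≅-trans K≅L L≅M ρ = proj₁ (L≅M ρ) ∘ proj₁ (K≅L ρ)
                   , proj₂ (K≅L ρ) ∘ proj₂ (L≅M ρ)

Remove-resp : {τ σ : Simplex V} → K ≅ L → Remove K τ σ ≅ Remove L τ σ
Remove-resp K≅L ρ = (λ (k , ≢τ , ≢σ) → proj₁ (K≅L ρ) k , ≢τ , ≢σ)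
                  , (λ (l , ≢τ , ≢σ) → proj₂ (K≅L ρ) l , ≢τ , ≢σ)

FreePair-resp : {τ σ : Simplex V} → K ≅ L → FreePair K τ σ → FreePair L τ σ
FreePair-resp {τ = τ} {σ = σ} K≅L (kτ , kσ , τ⊆σ , σ≢τ , cofaces) =
  proj₁ (K≅L τ) kτ , proj₁ (K≅L σ) kσ , τ⊆σ , σ≢τ ,
  λ ρ lρ τ⊆ρ → cofaces ρ (proj₂ (K≅L ρ) lρ) τ⊆ρ

module _ {ν : V → V} where

  Z₂Collapses-respˡ : K ≅ L → Z₂Collapses ν L M → Z₂Collapses ν K M
  Z₂Collapses-respˡ K≅L (done L≅M) = done (≅-trans K≅L L≅M)
  Z₂Collapses-respˡ K≅L (step τ σ free free-ν rest) =
    step τ σ (FreePair-resp (≅-sym K≅L) free)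
             (FreePair-resp (Remove-resp (≅-sym K≅L)) free-ν)
             (Z₂Collapses-respˡ (Remove-resp (Remove-resp K≅L)) rest)

  Z₂Collapses-trans : Z₂Collapses ν K L → Z₂Collapses ν L M → Z₂Collapses ν K M
  Z₂Collapses-trans (done K≅L)                 L↘M = Z₂Collapses-respˡ K≅L L↘M
  Z₂Collapses-trans (step τ σ free free-ν rest) L↘M =
    step τ σ free free-ν (Z₂Collapses-trans rest L↘M)

module Involution {ν : V → V} (ν-involutive : ∀ v → ν (ν v) ≡ v) where

  ·-cong : s ≐ t → (ν · s) ≐ (ν · t)
  ·-cong (s⊆t , t⊆s) = (λ v → s⊆t (ν v)) , (λ v → t⊆s (ν v))

  ·-involutive : (s : Simplex V) → (ν · (ν · s)) ≐ s
  ·-involutive s = ≗⇒≐ (cong s ∘ ν-involutive)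

  ·-transposeˡ : (ν · s) ≐ t → s ≐ (ν · t)
  ·-transposeˡ {s = s} νs≐t = ≐-trans (≐-sym (·-involutive s)) (·-cong νs≐t)

  ·-transposeʳ : s ≐ (ν · t) → (ν · s) ≐ t
  ·-transposeʳ = ≐-sym ∘ ·-transposeˡ ∘ ≐-sym

  ·-injective : (ν · s) ≐ (ν · t) → s ≐ t
  ·-injective {t = t} νs≐νt = ≐-trans (·-transposeˡ νs≐νt) (·-involutive t)

  ·-⊆-transpose : (ν · s) ⊆ₛ t → s ⊆ₛ (ν · t)
  ·-⊆-transpose {s = s} νs⊆t v v∈s =
    νs⊆t (ν v) (subst (λ u → s u ≡ true) (sym (ν-involutive v)) v∈s)

module DecidableVertices {V : Set} (_≟_ : DecidableEquality V) where

  infixl 30 _[_≔_]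
  _[_≔_] : Simplex V → V → Bool → Simplex V
  (s [ w ≔ x ]) v with v ≟ w
  ... | yes _ = x
  ... | no  _ = s v

  private
    variable
      v w : V
      x y : Bool

  ≔-same : (s [ w ≔ x ]) w ≡ x
  ≔-same {w = w} with w ≟ w
  ... | yes _   = refl
  ... | no  w≢w = contradiction refl w≢w

  ≔-other : v ≢ w → (s [ w ≔ x ]) v ≡ s v
  ≔-other {v = v} {w} v≢w with v ≟ w
  ... | yes v≡w = contradiction v≡w v≢w
  ... | no  _   = refl

  ≔-self : s w ≡ x → s [ w ≔ x ] ≗ s
  ≔-self {w = w} sw v with v ≟ w
  ... | yes refl = sym sw
  ... | no  _    = refl

  ≔-≔ : s [ w ≔ x ] [ w ≔ y ] ≗ s [ w ≔ y ]
  ≔-≔ {w = w} v with v ≟ w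
  ... | yes _   = refl
  ... | no  v≢w = ≔-other v≢w

  ≔-cong : s ≐ t → s [ w ≔ x ] ≐ t [ w ≔ x ]
  ≔-cong {s = s} {t = t} {w = w} {x = x} s≐t = ≗⇒≐ pointwise
    where
    pointwise : s [ w ≔ x ] ≗ t [ w ≔ x ]
    pointwise v with v ≟ w
    ... | yes _ = refl
    ... | no  _ = ≐⇒≗ s≐t v

  ≔-restore : s [ w ≔ x ] ≗ t → s ≗ t [ w ≔ s w ]
  ≔-restore {w = w} s≗t v with v ≟ w
  ... | yes refl = refl
  ... | no  v≢w  = trans (sym (≔-other v≢w)) (s≗t v)

  ⊆-≔true : s ⊆ₛ s [ w ≔ true ]
  ⊆-≔true {w = w} v v∈s with v ≟ w
  ... | yes _ = refl
  ... | no  _ = v∈s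

  ∈-≔true⁻ : v ∈ₛ s [ w ≔ true ] → v ≡ w ⊎ v ∈ₛ s
  ∈-≔true⁻ {v = v} {w = w} v∈ with v ≟ w
  ... | yes v≡w = inj₁ v≡w
  ... | no  _   = inj₂ v∈

  ≔false-⊆ : s [ w ≔ false ] ⊆ₛ s
  ≔false-⊆ {w = w} v v∈ with v ≟ w
  ... | yes _ = contradiction v∈ λ ()
  ... | no  _ = v∈

  ⊆-≔false : s ⊆ₛ t → s w ≡ false → s ⊆ₛ t [ w ≔ false ]
  ⊆-≔false {w = w} s⊆t sw v v∈s with v ≟ w
  ... | yes refl = contradiction (trans (sym v∈s) sw) λ ()
  ... | no  _    = s⊆t v v∈s

  ≔false-≐ : s [ w ≔ false ] ≐ t → s ≐ t ⊎ s ≐ t [ w ≔ true ]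
  ≔false-≐ {s = s} {w = w} {t = t} e with s w in sw | ≔-restore (≐⇒≗ e)
  ... | true  | s≗t[w≔true]  = inj₂ (≗⇒≐ s≗t[w≔true])
  ... | false | s≗t[w≔false] =
    inj₁ (≗⇒≐ λ v → trans (s≗t[w≔false] v) (≔-self tw v))
    where
    tw : t w ≡ false
    tw = trans (sym (≐⇒≗ e w)) ≔-same

  module StarCollapse
    (enum : Enumeration V) {ν : V → V} (ν-involutive : ∀ v → ν (ν v) ≡ v)
    (K : Complex V) (K? : ∀ ρ → Dec (K ρ))
    (K-resp : K Respects _≐_) (K-ν : ∀ {ρ} → K ρ → K (ν · ρ))
    (a b : V) (a≢b : a ≢ b)
    (K-a-νa : ∀ {ρ} → K ρ → a ∈ₛ ρ → ν a ∈ₛ ρ → ⊥)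
    (K-insert : ∀ {ρ} → K ρ → a ∈ₛ ρ → K (ρ [ b ≔ true ]))
    (K-erase : ∀ {ρ} → K ρ → a ∈ₛ ρ → K (ρ [ b ≔ false ]))
    where

    open Involution {ν = ν} ν-involutive
    open import Data.List.Membership.DecPropositional _≟_ using (_∈?_)

    private
      variable
        D D′ : Pred (Simplex V) 0ℓ

    -- The pairs (τ , τ ∪ {b}) with a ∈ τ ∌ b are the ones being collapsed; ρ is
    -- Matched by D when it belongs to such a pair whose lower member is in D.
    record Matched (D : Pred (Simplex V) 0ℓ) (ρ : Simplex V) : Set where
      constructor matched
      field
        a∈ρ     : a ∈ₛ ρ
        lower∈D : D (ρ [ b ≔ false ])

    Unmatched : Pred (Simplex V) 0ℓ → Complex V
    Unmatched D ρ = K ρ × ¬ Matched D ρ × ¬ Matched D (ν · ρ)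

    Matched-resp : D Respects _≐_ → (Matched D) Respects _≐_
    Matched-resp D-resp s≐t (matched a∈s d) =
      matched (proj₁ s≐t a a∈s) (D-resp (≔-cong s≐t) d)

    Matched-map : D ⊆ D′ → Matched D ρ → Matched D′ ρ
    Matched-map D⊆D′ (matched aρ d) = matched aρ (D⊆D′ d)

    ¬Matched-ν : K ρ → a ∈ₛ ρ → ¬ Matched D (ν · ρ)
    ¬Matched-ν k aρ (matched νaρ _) = K-a-νa k aρ νaρ

    Unmatched-anti : D ⊆ D′ → Unmatched D′ ρ → Unmatched D ρ
    Unmatched-anti D⊆D′ (k , ¬m , ¬mν) =
      k , ¬m ∘ Matched-map D⊆D′ , ¬mν ∘ Matched-map D⊆D′

    Unmatched-cong : D ⊆ D′ → D′ ⊆ D → Unmatched D ≅ Unmatched D′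
    Unmatched-cong D⊆D′ D′⊆D ρ = Unmatched-anti D′⊆D , Unmatched-anti D⊆D′

    Unmatched-ν : D Respects _≐_ → Unmatched D ρ → Unmatched D (ν · ρ)
    Unmatched-ν {ρ = ρ} D-resp (k , ¬m , ¬mν) =
      K-ν k , ¬mν , ¬m ∘ Matched-resp D-resp (·-involutive ρ)

    Unmatched-skip :
      (∀ {ρ} → K ρ → a ∈ₛ ρ → (ρ [ b ≔ false ]) ≐ τ → D (ρ [ b ≔ false ])) →
      Unmatched D ≅ Unmatched (D ∪ (_≐ τ))
    Unmatched-skip {τ = τ} {D = D} already ρ =
      (λ (k , ¬m , ¬mν) → k , absorb k ¬m , absorb (K-ν k) ¬mν) , Unmatched-anti inj₁
      where
      absorb : ∀ {ρ} → K ρ → ¬ Matched D ρ → ¬ Matched (D ∪ (_≐ τ)) ρ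
      absorb k ¬m (matched aρ (inj₁ d))     = ¬m (matched aρ d)
      absorb k ¬m (matched aρ (inj₂ ρ-b≐τ)) = ¬m (matched aρ (already k aρ ρ-b≐τ))

    -- the invariant under which τ is free when its turn comes
    LowerSupersetsWithin : (C D : Pred (Simplex V) 0ℓ) → Set
    LowerSupersetsWithin C D =
      ∀ {τ τ′} → C τ → τ ⊆ₛ τ′ → a ∈ₛ τ′ → τ′ b ≡ false → C τ′ ⊎ D τ′

    module Pair (D : Pred (Simplex V) 0ℓ) (D-resp : D Respects _≐_) (τ : Simplex V)
                (above : LowerSupersetsWithin (_≐ τ) D)
                (kτ : K τ) (aτ : a ∈ₛ τ) (bτ : τ b ≡ false) (¬Dτ : ¬ D τ) where

      σ : Simplex V
      σ = τ [ b ≔ true ]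

      kσ : K σ
      kσ = K-insert kτ aτ

      aσ : a ∈ₛ σ
      aσ = ⊆-≔true a aτ

      σ≢τ : ¬ σ ≐ τ
      σ≢τ σ≐τ = contradiction (trans (sym (proj₁ σ≐τ b ≔-same)) bτ) λ ()

      erase-τ : (τ [ b ≔ false ]) ≐ τ
      erase-τ = ≗⇒≐ (≔-self bτ)

      erase-σ : (σ [ b ≔ false ]) ≐ τ
      erase-σ = ≗⇒≐ λ v → trans (≔-≔ v) (≔-self bτ v)

      Matched⇒pair : Matched (_≐ τ) ρ → ρ ≐ τ ⊎ ρ ≐ σ
      Matched⇒pair (matched _ ρ-b≐τ) = ≔false-≐ ρ-b≐τ

      pair⇒Matched : ρ ≐ τ ⊎ ρ ≐ σ → Matched (_≐ τ) ρ
      pair⇒Matched (inj₁ ρ≐τ) =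
        matched (proj₂ ρ≐τ a aτ) (≐-trans (≔-cong ρ≐τ) erase-τ)
      pair⇒Matched (inj₂ ρ≐σ) =
        matched (proj₂ ρ≐σ a aσ) (≐-trans (≔-cong ρ≐σ) erase-σ)

      unmatched-τ : Unmatched D τ
      unmatched-τ = kτ , (λ (matched _ d) → ¬Dτ (D-resp erase-τ d)) , ¬Matched-ν kτ aτ

      unmatched-σ : Unmatched D σ
      unmatched-σ = kσ , (λ (matched _ d) → ¬Dτ (D-resp erase-σ d)) , ¬Matched-ν kσ aσ

      cofaces : ∀ ρ → Unmatched D ρ → τ ⊆ₛ ρ → ρ ≐ τ ⊎ ρ ≐ σ
      cofaces ρ (_ , ¬m , _) τ⊆ρ
        with above ≐-refl (⊆-≔false τ⊆ρ bτ) (trans (≔-other a≢b) (τ⊆ρ a aτ)) ≔-same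
      ... | inj₁ ρ-b≐τ = ≔false-≐ ρ-b≐τ
      ... | inj₂ d     = contradiction (matched (τ⊆ρ a aτ) d) ¬m

      free : FreePair (Unmatched D) τ σ
      free = unmatched-τ , unmatched-σ , (λ v → ⊆-≔true v) , σ≢τ , cofaces

      antipode-apart : ∀ {ρ ρ′} → K ρ → a ∈ₛ ρ → a ∈ₛ ρ′ → ¬ (ν · ρ) ≐ ρ′
      antipode-apart k aρ aρ′ νρ≐ρ′ = K-a-νa k aρ (proj₂ νρ≐ρ′ a aρ′)

      free-ν : FreePair (Remove (Unmatched D) τ σ) (ν · τ) (ν · σ)
      free-ν =
        ( Unmatched-ν D-resp unmatched-τ
        , antipode-apart kτ aτ aτ , antipode-apart kτ aτ aσ) ,
        ( Unmatched-ν D-resp unmatched-σ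
        , antipode-apart kσ aσ aτ , antipode-apart kσ aσ aσ) ,
        (λ v → ⊆-≔true (ν v)) , σ≢τ ∘ ·-injective ,
        λ ρ (uρ , _ , _) ντ⊆ρ →
          Sum.map ·-transposeˡ ·-transposeˡ
            (cofaces (ν · ρ) (Unmatched-ν D-resp uρ) (·-⊆-transpose ντ⊆ρ))

      Collapsed : Complex V
      Collapsed = Remove (Remove (Unmatched D) τ σ) (ν · τ) (ν · σ)

      collapsed : Collapsed ≅ Unmatched (D ∪ (_≐ τ))
      collapsed ρ = to , from
        where
        absorb : ∀ {ρ} → ¬ Matched D ρ → ¬ (ρ ≐ τ ⊎ ρ ≐ σ) → ¬ Matched (D ∪ (_≐ τ)) ρ
        absorb ¬m ¬pair (matched aρ (inj₁ d))     = ¬m (matched aρ d)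
        absorb ¬m ¬pair (matched aρ (inj₂ ρ-b≐τ)) =
          ¬pair (Matched⇒pair (matched aρ ρ-b≐τ))

        to : Collapsed ρ → Unmatched (D ∪ (_≐ τ)) ρ
        to (((k , ¬m , ¬mν) , ρ≢τ , ρ≢σ) , ρ≢ντ , ρ≢νσ) =
          k , absorb ¬m [ ρ≢τ , ρ≢σ ] ,
          absorb ¬mν [ ρ≢ντ ∘ ·-transposeˡ , ρ≢νσ ∘ ·-transposeˡ ]

        from : Unmatched (D ∪ (_≐ τ)) ρ → Collapsed ρ
        from u@(_ , ¬m , ¬mν) =
          ( (Unmatched-anti inj₁ u
            , ¬m ∘ Matched-map inj₂ ∘ pair⇒Matched ∘ inj₁
            , ¬m ∘ Matched-map inj₂ ∘ pair⇒Matched ∘ inj₂)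
          , ¬mν ∘ Matched-map inj₂ ∘ pair⇒Matched ∘ inj₁ ∘ ·-transposeʳ
          , ¬mν ∘ Matched-map inj₂ ∘ pair⇒Matched ∘ inj₂ ∘ ·-transposeʳ)

    processSimplex : Decidable D → D Respects _≐_ → (τ : Simplex V) →
                     LowerSupersetsWithin (_≐ τ) D →
                     Z₂Collapses ν (Unmatched D) (Unmatched (D ∪ (_≐ τ)))
    processSimplex {D = D} D? D-resp τ above
      with K? τ ×-dec τ a ≟ᴮ true ×-dec τ b ≟ᴮ false ×-dec ¬? (D? τ)
    ... | yes (kτ , aτ , bτ , ¬Dτ) = step τ σ free free-ν (done collapsed)
      where open Pair D D-resp τ above kτ aτ bτ ¬Dτ
    ... | no unpairable = done (Unmatched-skip already)
      where
      already : ∀ {ρ} → K ρ → a ∈ₛ ρ → (ρ [ b ≔ false ]) ≐ τ → D (ρ [ b ≔ false ])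
      already k aρ ρ-b≐τ = D-resp (≐-sym ρ-b≐τ) (decidable-stable (D? τ) λ ¬Dτ →
        unpairable ( K-resp ρ-b≐τ (K-erase k aρ)
                   , proj₁ ρ-b≐τ a (trans (≔-other a≢b) aρ)
                   , trans (sym (≐⇒≗ ρ-b≐τ b)) ≔-same
                   , ¬Dτ))

    Cube : Simplex V → List V → Pred (Simplex V) 0ℓ
    Cube F ws τ = ∀ v → v ∉ ws → τ v ≡ F v

    Cube? : ∀ F ws → Decidable (Cube F ws)
    Cube? F ws τ = ∀? enum λ v → ¬? (v ∈? ws) →-dec τ v ≟ᴮ F v

    Cube-resp : ∀ F ws → (Cube F ws) Respects _≐_
    Cube-resp F ws s≐t cube v v∉ws = trans (sym (≐⇒≗ s≐t v)) (cube v v∉ws)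

    Cube-widen : ∀ {F w ws x} → Cube (F [ w ≔ x ]) ws τ → Cube F (w ∷ ws) τ
    Cube-widen cube v v∉w∷ws =
      trans (cube v (v∉w∷ws ∘ there)) (≔-other (v∉w∷ws ∘ here))

    Cube-narrow : ∀ {F w ws x} → Cube F (w ∷ ws) τ → (w ∉ ws → τ w ≡ x) →
                  Cube (F [ w ≔ x ]) ws τ
    Cube-narrow {w = w} cube τw v v∉ws with v ≟ w
    ... | yes refl = τw v∉ws
    ... | no  v≢w  = cube v λ { (here v≡w) → v≢w v≡w ; (there v∈ws) → v∉ws v∈ws }

    Cube-split : ∀ {F w ws} → Cube F (w ∷ ws) τ →
                 Cube (F [ w ≔ true ]) ws τ ⊎ Cube (F [ w ≔ false ]) ws τ
    Cube-split {τ = τ} {w = w} cube with τ w in τw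
    ... | true  = inj₁ (Cube-narrow cube (const τw))
    ... | false = inj₂ (Cube-narrow cube (const τw))

    Cube-[] : ∀ {F} → Cube F [] τ → τ ≐ F
    Cube-[] cube = ≗⇒≐ λ v → cube v λ ()

    -- Recursing on the w = true half first processes supersets before subsets.
    processCube : ∀ ws F → Decidable D → D Respects _≐_ →
                  LowerSupersetsWithin (Cube F ws) D →
                  Z₂Collapses ν (Unmatched D) (Unmatched (D ∪ Cube F ws))
    processCube [] F D? D-resp above =
      Z₂Collapses-trans
        (processSimplex D? D-resp F λ τ≐F τ⊆τ′ aτ′ bτ′ →
           Sum.map₁ Cube-[] (above (λ v _ → ≐⇒≗ τ≐F v) τ⊆τ′ aτ′ bτ′))
        (done (Unmatched-cong (Sum.map₂ λ τ≐F v _ → ≐⇒≗ τ≐F v) (Sum.map₂ Cube-[])))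
    processCube {D = D} (w ∷ ws) F D? D-resp above =
      Z₂Collapses-trans (processCube ws F₁ D? D-resp above₁)
        (Z₂Collapses-trans
          (processCube ws F₀ (D? ∪? Cube? F₁ ws)
                       (λ s≐t → Sum.map (D-resp s≐t) (Cube-resp F₁ ws s≐t)) above₀)
          (done (Unmatched-cong [ [ inj₁ , inj₂ ∘ Cube-widen ] , inj₂ ∘ Cube-widen ]
                                [ inj₁ ∘ inj₁ , [ inj₁ ∘ inj₂ , inj₂ ] ∘ Cube-split ])))
      where
      F₁ F₀ : Simplex V
      F₁ = F [ w ≔ true ]
      F₀ = F [ w ≔ false ]

      above₁ : LowerSupersetsWithin (Cube F₁ ws) D
      above₁ cube τ⊆τ′ aτ′ bτ′ =
        Sum.map₁ (λ cube′ → Cube-narrow cube′ λ w∉ws → τ⊆τ′ w (trans (cube w w∉ws) ≔-same))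
          (above (Cube-widen cube) τ⊆τ′ aτ′ bτ′)

      above₀ : LowerSupersetsWithin (Cube F₀ ws) (D ∪ Cube F₁ ws)
      above₀ cube τ⊆τ′ aτ′ bτ′ =
        [ [ inj₂ ∘ inj₂ , inj₁ ]′ ∘ Cube-split , inj₂ ∘ inj₁ ]′
          (above (Cube-widen cube) τ⊆τ′ aτ′ bτ′)

    Cube-everything : ∀ {F} → Cube F (elements enum) τ
    Cube-everything v v∉ = contradiction (complete enum v) v∉

    collapseStar : Z₂Collapses ν K (λ ρ → K ρ × ¬ a ∈ₛ ρ × ¬ ν a ∈ₛ ρ)
    collapseStar =
      Z₂Collapses-respˡ nothing-matched
        (Z₂Collapses-trans
          (processCube vs F ∅? (λ _ ()) λ _ _ _ _ → inj₁ Cube-everything)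
          (done everything-matched))
      where
      vs : List V
      vs = elements enum

      F : Simplex V
      F = const false

      nothing-matched : K ≅ Unmatched ∅
      nothing-matched ρ = (λ k → k , Matched.lower∈D , Matched.lower∈D) , proj₁

      matched-if-a∈ : ∀ {ρ} → a ∈ₛ ρ → Matched (∅ ∪ Cube F vs) ρ
      matched-if-a∈ aρ = matched aρ (inj₂ Cube-everything)

      everything-matched : Unmatched (∅ ∪ Cube F vs) ≅ λ ρ → K ρ × ¬ a ∈ₛ ρ × ¬ ν a ∈ₛ ρ
      everything-matched ρ =
        (λ (k , ¬m , ¬mν) → k , ¬m ∘ matched-if-a∈ , ¬mν ∘ matched-if-a∈) ,
        (λ (k , a∉ρ , νa∉ρ) → k , a∉ρ ∘ Matched.a∈ρ , νa∉ρ ∘ Matched.a∈ρ)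

_≟ᴾ_ : DecidableEquality Pole
○ ≟ᴾ ○ = yes refl
○ ≟ᴾ ● = no λ ()
● ≟ᴾ ○ = no λ ()
● ≟ᴾ ● = yes refl

swap-involutive : (v : A × Pole) → swap (swap v) ≡ v
swap-involutive (_ , ○) = refl
swap-involutive (_ , ●) = refl

module BoxComplex {U : Set} (_≟_ : DecidableEquality U) (Adj : U → U → Set)
                  (Adj-sym : ∀ {x y} → Adj x y → Adj y x) where

  _≟ⱽ_ : DecidableEquality (U × Pole)
  _≟ⱽ_ = Product.≡-dec _≟_ _≟ᴾ_

  open DecidableVertices _≟ⱽ_

  private
    variable
      σ σ′ : Simplex (U × Pole)
      x x′ : U
      p : Pole

  Box-face : σ′ ⊆ₛ σ → Σ (U × Pole) (_∈ₛ σ′) → Box Adj σ → Box Adj σ′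
  Box-face σ′⊆σ nonempty (_ , σ°⋈σ• , (c° , c°-common) , (c• , c•-common)) =
    nonempty ,
    (λ y z y∈ z∈ → σ°⋈σ• y z (σ′⊆σ _ y∈) (σ′⊆σ _ z∈)) ,
    (c° , λ y y∈ → c°-common y (σ′⊆σ _ y∈)) ,
    (c• , λ y y∈ → c•-common y (σ′⊆σ _ y∈))

  Box-resp : (Box Adj) Respects _≐_
  Box-resp s≐t box@((v , v∈s) , _) = Box-face (proj₂ s≐t) (v , proj₁ s≐t v v∈s) box

  ∈-swap : ∀ {v} → v ∈ₛ σ → swap v ∈ₛ (swap · σ)
  ∈-swap {v = _ , ○} v∈ = v∈
  ∈-swap {v = _ , ●} v∈ = v∈

  Box-swap : Box Adj σ → Box Adj (swap · σ)
  Box-swap {σ = σ} ((v , v∈) , σ°⋈σ• , common° , common•) =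
    (swap v , ∈-swap {σ = σ} v∈) ,
    (λ y z y∈ z∈ → Adj-sym (σ°⋈σ• z y z∈ y∈)) ,
    common• , common°

  Box-insert : (∀ {y} → Adj x y → Adj x′ y) → (x , ○) ∈ₛ σ → Box Adj σ →
               Box Adj (σ [ (x′ , ○) ≔ true ])
  Box-insert {x = x} {x′} {σ} inherits x°∈ (_ , σ°⋈σ• , (c° , c°-common) , (c• , c•-common)) =
    ((x′ , ○) , ≔-same) , ⋈⁺ , (c° , c°-common⁺) , (c• , c•-common⁺)
    where
    σ⁺ : Simplex (U × Pole)
    σ⁺ = σ [ (x′ , ○) ≔ true ]

    ⋈⁺ : ∀ y z → (y , ○) ∈ₛ σ⁺ → (z , ●) ∈ₛ σ⁺ → Adj y z
    ⋈⁺ y z y∈ z∈ with ∈-≔true⁻ z∈ | ∈-≔true⁻ y∈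
    ... | inj₂ z∈σ | inj₁ refl = inherits (σ°⋈σ• x z x°∈ z∈σ)
    ... | inj₂ z∈σ | inj₂ y∈σ  = σ°⋈σ• y z y∈σ z∈σ

    c°-common⁺ : ∀ y → (y , ○) ∈ₛ σ⁺ → Adj y c°
    c°-common⁺ y y∈ with ∈-≔true⁻ y∈
    ... | inj₁ refl = inherits (c°-common x x°∈)
    ... | inj₂ y∈σ  = c°-common y y∈σ

    c•-common⁺ : ∀ y → (y , ●) ∈ₛ σ⁺ → Adj y c•
    c•-common⁺ y y∈ with ∈-≔true⁻ y∈
    ... | inj₂ y∈σ = c•-common y y∈σ

  Box-neighbour : Box Adj σ → (x , p) ∈ₛ σ → ∃ (Adj x)
  Box-neighbour {p = ○} (_ , _ , (c , c-common) , _) x∈ = c , c-common _ x∈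
  Box-neighbour {p = ●} (_ , _ , _ , (c , c-common)) x∈ = c , c-common _ x∈

  Box? : Enumeration U → (∀ x y → Dec (Adj x y)) → ∀ σ → Dec (Box Adj σ)
  Box? enum Adj? σ =
    ∃? (×-enum enum Pole-enum) (λ v → σ v ≟ᴮ true) ×-dec
    ∀? enum (λ y → ∀? enum λ z →
      σ (y , ○) ≟ᴮ true →-dec σ (z , ●) ≟ᴮ true →-dec Adj? y z) ×-dec
    ∃? enum (λ c → ∀? enum λ y → σ (y , ○) ≟ᴮ true →-dec Adj? y c) ×-dec
    ∃? enum (λ c → ∀? enum λ y → σ (y , ●) ≟ᴮ true →-dec Adj? y c)

∣p∣≡1+k⇒Nonempty : ∀ {n k} {p : Subset n} → ∣ p ∣ ≡ suc k → Nonempty p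
∣p∣≡1+k⇒Nonempty {n} {p = p} ∣p∣≡1+k = decidable-stable (nonempty? p) λ empty →
  ℕ.0≢1+n (trans (sym (trans (cong ∣_∣ (Empty-unique empty)) (∣⊥∣≡0 n))) ∣p∣≡1+k)

module _ {n : ℕ} (E : Fin n → Fin n → Bool) where

  ⋈? : ∀ A B → Dec (_⋈_ E A B)
  ⋈? A B = all? λ u → all? λ v → u ∈ˢ? A →-dec v ∈ˢ? B →-dec E u v ≟ᴮ true

  IsΩVertex? : ∀ {ℓ} (A : Vec (Subset n) (suc ℓ)) → Dec (IsΩVertex E A)
  IsΩVertex? A = ∣ head A ∣ ℕ.≟ 1 ×-dec all? λ _ → ⋈? _ _

  ΩAdj? : ∀ {ℓ} (A B : Vec (Subset n) (suc ℓ)) → Dec (ΩAdj E A B)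
  ΩAdj? A B = IsΩVertex? A ×-dec IsΩVertex? B ×-dec
              all? (λ _ → _ ⊆? _) ×-dec all? (λ _ → _ ⊆? _) ×-dec ⋈? _ _

module LooplessGraph {n : ℕ} (E : Fin n → Fin n → Bool)
                     (E-sym : ∀ u v → E u v ≡ E v u)
                     (E-irrefl : ∀ v → E v v ≡ false) where

  ΩAdj-sym : ∀ {ℓ} {A B : Vec (Subset n) (suc ℓ)} → ΩAdj E A B → ΩAdj E B A
  ΩAdj-sym (vA , vB , A⊆B , B⊆A , A⋈B) =
    vB , vA , B⊆A , A⊆B , λ u v u∈ v∈ → trans (E-sym u v) (A⋈B v u v∈ u∈)

  ΩAdj-irrefl : ∀ {ℓ} {A : Vec (Subset n) (suc (suc ℓ))} → ¬ ΩAdj E A A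
  ΩAdj-irrefl {A = _ ∷ _} ((∣A₀∣≡1 , A⋈A) , _ , A⊆A , _ , _) =
    let (u , u∈A₀) = ∣p∣≡1+k⇒Nonempty ∣A₀∣≡1 in
    contradiction (trans (sym (A⋈A zero u u u∈A₀ (A⊆A zero u∈A₀))) (E-irrefl u)) λ ()

  module Ω′Collapse (m : ℕ) where

    Tuple : Set
    Tuple = Vec (Subset n) (suc (suc m))

    Tuple-enum : Enumeration Tuple
    Tuple-enum = Vec-enum (Vec-enum Bool-enum n) (suc (suc m))

    _≟ᵀ_ : DecidableEquality Tuple
    _≟ᵀ_ = Vec.≡-dec (Vec.≡-dec _≟ᴮ_)

    Ω′ : Tuple → Tuple → Set
    Ω′ = Ω'Adj E {m}

    Imφ : Tuple → Set
    Imφ X = ImφPoles E {m} (X , ○)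

    Removable : Tuple → Set
    Removable X = IsΩVertex E X × ¬ Imφ X

    private
      variable
        X Y : Tuple

    Ω′? : ∀ X Y → Dec (Ω′ X Y)
    Ω′? X Y = ∃? Tuple-enum λ A → ∃? Tuple-enum λ B →
      ΩAdj? E A B ×-dec (X ≟ᵀ A ⊎-dec X ≟ᵀ φ E A) ×-dec (Y ≟ᵀ B ⊎-dec Y ≟ᵀ φ E B)

    Imφ? : Decidable Imφ
    Imφ? X = ∃? Tuple-enum λ A → IsΩVertex? E A ×-dec X ≟ᵀ φ E A

    Removable? : Decidable Removable
    Removable? X = IsΩVertex? E X ×-dec ¬? (Imφ? X)

    Ω′-sym : Ω′ X Y → Ω′ Y X
    Ω′-sym (A , B , A~B , X≈A , Y≈B) = B , A , ΩAdj-sym {A = A} {B} A~B , Y≈B , X≈A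

    Ω′-loop⇒Imφ : Ω′ X X → Imφ X
    Ω′-loop⇒Imφ (A , _ , (vA , _) , inj₂ X≡φA , _)          = A , vA , X≡φA
    Ω′-loop⇒Imφ (_ , B , (_ , vB , _) , inj₁ _ , inj₂ X≡φB) = B , vB , X≡φB
    Ω′-loop⇒Imφ (A , _ , A~A , inj₁ refl , inj₁ refl)       = ⊥-elim (ΩAdj-irrefl {A = A} A~A)

    Ω′-φ : ¬ Imφ X → Ω′ X Y → Ω′ (φ E X) Y
    Ω′-φ _     (A , B , A~B , inj₁ refl , Y≈B) = A , B , A~B , inj₂ refl , Y≈B
    Ω′-φ X∉imφ (A , _ , A~B , inj₂ X≡φA , _)  = ⊥-elim (X∉imφ (A , proj₁ A~B , X≡φA))

    Ω′-source : Ω′ X Y → IsΩVertex E X ⊎ Imφ X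
    Ω′-source (A , _ , A~B , inj₁ refl , _)  = inj₁ (proj₁ A~B)
    Ω′-source (A , _ , A~B , inj₂ X≡φA , _) = inj₂ (A , proj₁ A~B , X≡φA)

    open BoxComplex _≟ᵀ_ Ω′ Ω′-sym
    open DecidableVertices _≟ⱽ_

    Avoiding : List Tuple → Complex (Tuple × Pole)
    Avoiding L = Induced (Box Ω′) (λ v → proj₁ v ∉ L)

    Avoiding? : ∀ L ρ → Dec (Avoiding L ρ)
    Avoiding? L ρ = Box? Tuple-enum Ω′? ρ ×-dec
      ∀? (×-enum Tuple-enum Pole-enum) λ v → ρ v ≟ᴮ true →-dec ¬? (any? (proj₁ v ≟ᵀ_) L)

    Avoiding-resp : ∀ L → (Avoiding L) Respects _≐_
    Avoiding-resp L s≐t (box , avoid) =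
      Box-resp s≐t box , λ v v∈t → avoid v (proj₂ s≐t v v∈t)

    Avoiding-swap : ∀ L {ρ} → Avoiding L ρ → Avoiding L (swap · ρ)
    Avoiding-swap L {ρ} (box , avoid) = Box-swap {σ = ρ} box , λ v → avoid (swap v)

    collapseVertex : ∀ {L X} → All Removable L → Removable X →
                     Z₂Collapses swap (Avoiding L) (Avoiding (X ∷ L))
    collapseVertex {L} {X} L-removable (X-vertex , X∉imφ) =
      Z₂Collapses-trans
        (StarCollapse.collapseStar (×-enum Tuple-enum Pole-enum) swap-involutive
           (Avoiding L) (Avoiding? L) (Avoiding-resp L) (Avoiding-swap L)
           (X , ○) (φ E X , ○) X°≢φX° no-loop insert-φX° erase-φX°)
        (done λ ρ → to , from)
      where
      X°≢φX° : (X , ○) ≢ (φ E X , ○)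
      X°≢φX° X°≡φX° = X∉imφ (X , X-vertex , cong proj₁ X°≡φX°)

      no-loop : ∀ {ρ} → Avoiding L ρ → (X , ○) ∈ₛ ρ → (X , ●) ∈ₛ ρ → ⊥
      no-loop ((_ , ρ°⋈ρ• , _) , _) X°∈ X•∈ = X∉imφ (Ω′-loop⇒Imφ (ρ°⋈ρ• X X X°∈ X•∈))

      φX∉L : φ E X ∉ L
      φX∉L φX∈L = proj₂ (All.lookup L-removable φX∈L) (X , X-vertex , refl)

      insert-φX° : ∀ {ρ} → Avoiding L ρ → (X , ○) ∈ₛ ρ → Avoiding L (ρ [ (φ E X , ○) ≔ true ])
      insert-φX° {ρ} (box , avoid) X°∈ =
        Box-insert (Ω′-φ X∉imφ) X°∈ box ,
        λ v v∈ → [ (λ { refl → φX∉L }) , avoid v ]′ (∈-≔true⁻ {s = ρ} v∈)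

      erase-φX° : ∀ {ρ} → Avoiding L ρ → (X , ○) ∈ₛ ρ → Avoiding L (ρ [ (φ E X , ○) ≔ false ])
      erase-φX° (box , avoid) X°∈ =
        Box-face ≔false-⊆ ((X , ○) , trans (≔-other X°≢φX°) X°∈) box ,
        λ v v∈ → avoid v (≔false-⊆ v v∈)

      to : ∀ {ρ} → Avoiding L ρ × ¬ (X , ○) ∈ₛ ρ × ¬ (X , ●) ∈ₛ ρ → Avoiding (X ∷ L) ρ
      to ((box , avoid) , X°∉ , X•∉) = box , λ
        { (_ , ○) Y∈ (here refl) → X°∉ Y∈
        ; (_ , ●) Y∈ (here refl) → X•∉ Y∈
        ; v v∈ (there v∈L) → avoid v v∈ v∈L }

      from : ∀ {ρ} → Avoiding (X ∷ L) ρ → Avoiding L ρ × ¬ (X , ○) ∈ₛ ρ × ¬ (X , ●) ∈ₛ ρ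
      from (box , avoid) =
        (box , λ v v∈ → avoid v v∈ ∘ there) ,
        (λ X°∈ → avoid _ X°∈ (here refl)) , (λ X•∈ → avoid _ X•∈ (here refl))

    collapseAll : ∀ {L} → All Removable L → Z₂Collapses swap (Box Ω′) (Avoiding L)
    collapseAll []                          = done λ ρ → (λ box → box , λ _ _ ()) , proj₁
    collapseAll (X-removable ∷ L-removable) =
      Z₂Collapses-trans (collapseAll L-removable) (collapseVertex L-removable X-removable)

    removables : List Tuple
    removables = filter Removable? (elements Tuple-enum)

    Avoiding-removables : Avoiding removables ≅ Induced (Box Ω′) (ImφPoles E)
    Avoiding-removables ρ =
      (λ (box , avoid) → box , λ v v∈ → on-imφ box v v∈ (avoid v v∈)) ,
      (λ (box , on-imφ) → box , λ v v∈ v∈rem → proj₂ (removable v∈rem) (on-imφ v v∈))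
      where
      removable : ∀ {Y} → Y ∈ removables → Removable Y
      removable = proj₂ ∘ ∈-filter⁻ Removable? {xs = elements Tuple-enum}

      on-imφ : Box Ω′ ρ → ∀ v → v ∈ₛ ρ → proj₁ v ∉ removables → Imφ (proj₁ v)
      on-imφ box (Y , _) Y∈ Y∉ = decidable-stable (Imφ? Y) λ Y∉imφ →
        [ (λ Y-vertex → Y∉ (∈-filter⁺ Removable? (complete Tuple-enum Y) (Y-vertex , Y∉imφ)))
        , Y∉imφ ]′ (Ω′-source (proj₂ (Box-neighbour box Y∈)))

lemma5p2 : (n : ℕ) (E : Fin n → Fin n → Bool) →
    (∀ u v → E u v ≡ E v u) → (∀ v → E v v ≡ false) →
    (m : ℕ) →
    Z₂Collapses swap (Box (Ω'Adj E {m}))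
      (Induced (Box (Ω'Adj E {m})) (ImφPoles E {m}))
lemma5p2 n E E-sym E-irrefl m =
  Z₂Collapses-trans (collapseAll (all-filter Removable? (elements Tuple-enum)))
                    (done Avoiding-removables)
  where
  open LooplessGraph E E-sym E-irrefl
  open Ω′Collapse m
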